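{- Let $n$ be a positive integer and let $r \in \{0,1,\ldots,\lfloor n/2\rfloor - 1\}$. Then $r \in S(n)$ if and only if $n - r$ has a proper divisor $k$ with $k \ge r+1$.
   Context: $n \bmod k$ denotes the least nonnegative remainder of $n$ upon division by $k$. $S(n) := \{ n \bmod k : k \in \{1,2,\ldots,\lfloor n/2\rfloor\}\}$. A proper divisor of a positive integer $m$ is a positive divisor of $m$ different from $m$. -}

module Defs where

open import Data.Nat using (ℕ; suc; _≤_; _/_; _%_; NonZero)
open import Data.Nat.Divisibility using (_∣_)
open import Data.Product using (Σ; _×_)
open import Relation.Binary.PropositionalEquality using (_≡_; _≢_)

-- r ∈ S(n) = { n mod k : k ∈ {1, …, ⌊n/2⌋} }.
-- k ranges over positive naturals, written k = suc j (so 1 ≤ k holds by construction).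
InS : ℕ → ℕ → Set
InS n r = Σ ℕ λ j → (suc j ≤ n / 2) × (n % suc j ≡ r)

ProperDivisor : ℕ → ℕ → Set
ProperDivisor k m = (1 ≤ k) × (k ∣ m) × (k ≢ m)

{-# OPTIONS --safe #-}
-- If n mod k = r then k divides n − r, and a k ≤ n/2 is a proper divisor of n − r because
-- k + r < n/2 + n/2 ≤ n; being a remainder, r < k. Conversely a proper divisor k of n − r is
-- at most (n − r)/2 ≤ n/2, and r < k makes r the remainder of n = (n − r) + r modulo k.
module Submission where

open import Defs
open import Data.Nat using (ℕ; suc; zero; _≤_; _<_; _+_; _∸_; _/_; _%_; _*_; s≤s; z≤n; NonZero)
open import Data.Nat.Properties
open import Data.Nat.DivMod
open import Data.Nat.Divisibility using (_∣_; divides)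
open import Data.Product using (Σ; _×_; _,_)
open import Function.Bundles using (_⇔_; mk⇔)
open import Relation.Binary.PropositionalEquality
open import Relation.Nullary using (contradiction)

m%n≡o⇒n∣m∸o : ∀ {m n o} .{{_ : NonZero n}} → m % n ≡ o → n ∣ m ∸ o
m%n≡o⇒n∣m∸o {m} {n} {o} m%n≡o = divides (m / n) (begin
  m ∸ o                     ≡⟨ cong (_∸ o) (m≡m%n+[m/n]*n m n) ⟩
  m % n + m / n * n ∸ o     ≡⟨ cong (λ x → x + m / n * n ∸ o) m%n≡o ⟩
  o + m / n * n ∸ o         ≡⟨ m+n∸m≡n o (m / n * n) ⟩
  m / n * n                 ∎)
  where open ≡-Reasoning

n∣m∸o⇒m%n≡o : ∀ {m n o} .{{_ : NonZero n}} → o ≤ m → o < n → n ∣ m ∸ o → m % n ≡ o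
n∣m∸o⇒m%n≡o {m} {n} {o} o≤m o<n n∣m∸o = begin
  m % n             ≡⟨ cong (_% n) (m∸n+n≡m o≤m) ⟨
  (m ∸ o + o) % n   ≡⟨ %-remove-+ˡ o n∣m∸o ⟩
  o % n             ≡⟨ m<n⇒m%n≡m o<n ⟩
  o                 ∎
  where open ≡-Reasoning

m/2+m/2≤m : ∀ m → m / 2 + m / 2 ≤ m
m/2+m/2≤m m = begin
  m / 2 + m / 2   ≡⟨ cong (m / 2 +_) (+-identityʳ (m / 2)) ⟨
  2 * (m / 2)     ≡⟨ *-comm 2 (m / 2) ⟩
  m / 2 * 2       ≤⟨ m/n*n≤m m 2 ⟩
  m               ∎
  where open ≤-Reasoning

m≤o/2⇒n<o/2⇒m<o∸n : ∀ {m n o} → m ≤ o / 2 → n < o / 2 → m < o ∸ n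
m≤o/2⇒n<o/2⇒m<o∸n {m} {o = o} m≤o/2 n<o/2 =
  m+n≤o⇒m≤o∸n (suc m) (<-≤-trans (+-mono-≤-< m≤o/2 n<o/2) (m/2+m/2≤m o))

m∣n⇒m≢n⇒m≤n/2 : ∀ {m n} → 0 < n → m ∣ n → m ≢ n → m ≤ n / 2
m∣n⇒m≢n⇒m≤n/2 {m} {n} 0<n m∣n m≢n =
  subst (_≤ n / 2) (m*n/n≡m m 2) (/-monoˡ-≤ 2 (m*2≤n m∣n))
  where
  m*2≤n : m ∣ n → m * 2 ≤ n
  m*2≤n (divides zero n≡0) = contradiction n≡0 (>⇒≢ 0<n)
  m*2≤n (divides (suc zero) n≡1*m) = contradiction (sym (trans n≡1*m (*-identityˡ m))) m≢n
  m*2≤n (divides q@(suc (suc p)) refl) = begin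
    m * 2   ≡⟨ *-comm m 2 ⟩
    2 * m   ≤⟨ *-monoˡ-≤ m (m≤m+n 2 p) ⟩
    q * m   ∎
    where open ≤-Reasoning

-- The hypothesis 1 ≤ n is implied by r < n / 2.
lemma2p4 : (n r : ℕ) → 1 ≤ n → r < n / 2 →
    InS n r ⇔ (Σ ℕ λ k → ProperDivisor k (n ∸ r) × (r + 1 ≤ k))
lemma2p4 n r _ r<n/2 = mk⇔ to from
  where
  r<n : r < n
  r<n = <-≤-trans r<n/2 (m/n≤m n 2)

  to : InS n r → Σ ℕ λ k → ProperDivisor k (n ∸ r) × (r + 1 ≤ k)
  to (j , k≤n/2 , n%k≡r) =
    suc j , (s≤s z≤n , m%n≡o⇒n∣m∸o n%k≡r , <⇒≢ (m≤o/2⇒n<o/2⇒m<o∸n k≤n/2 r<n/2)) , r+1≤k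
    where
    r+1≤k : r + 1 ≤ suc j
    r+1≤k = subst (_≤ suc j) (+-comm 1 r) (subst (_< suc j) n%k≡r (m%n<n n (suc j)))

  from : (Σ ℕ λ k → ProperDivisor k (n ∸ r) × (r + 1 ≤ k)) → InS n r
  from (suc j , (s≤s z≤n , k∣n∸r , k≢n∸r) , r+1≤k) = j , k≤n/2 , n%k≡r
    where
    k≤n/2 : suc j ≤ n / 2
    k≤n/2 = ≤-trans (m∣n⇒m≢n⇒m≤n/2 (m<n⇒0<n∸m r<n) k∣n∸r k≢n∸r) (/-monoˡ-≤ 2 (m∸n≤m n r))
    n%k≡r : n % suc j ≡ r
    n%k≡r = n∣m∸o⇒m%n≡o (<⇒≤ r<n) (subst (_≤ suc j) (+-comm r 1) r+1≤k) k∣n∸r
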